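{- Let $t$ be a positive integer and let $m_1, m_2, \ldots, m_t$ be positive integers. Then \[ m_1^t + m_2^t + \cdots + m_t^t \geq \frac{t!}{t^t} \left(\binom{m_1 + m_2 + \cdots + m_t}{t} + \cdots + \binom{m_1 + m_2}{2} + \binom{m_1}{1}\right), \] i.e. $\sum_{i=1}^t m_i^t \geq \frac{t!}{t^t}\sum_{j=1}^{t} \binom{m_1+\cdots+m_j}{j}$. -}

module Defs where

open import Data.Nat using (ℕ; zero; suc; _+_)
open import Data.Fin using (Fin; toℕ)
import Data.Fin as F

sumFin : (n : ℕ) → (Fin n → ℕ) → ℕ
sumFin zero    f = 0
sumFin (suc n) f = f F.zero + sumFin n (λ i → f (F.suc i))

prefixSum : {t : ℕ} → (Fin t → ℕ) → ℕ → ℕ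
prefixSum {zero}  m j       = 0
prefixSum {suc t} m zero    = 0
prefixSum {suc t} m (suc j) = m F.zero + prefixSum {t} (λ i → m (F.suc i)) j

{-# OPTIONS --safe #-}
module Submission where

-- Each of the t summands is bounded separately.  For j ≤ t put S = m₁ + … + m_j.  Then
-- t! ≤ j! t^(t-j) and j! C(S, j) ≤ S^j, while the power-mean inequality (a consequence of
-- Chebyshev's sum inequality) gives S^j ≤ j^(j-1) (m₁^j + … + m_j^j) ≤ t^(j-1) Σᵢ mᵢ^t,
-- the last step using mᵢ ≥ 1.  Hence t! C(S, j) ≤ t^(t-1) Σᵢ mᵢ^t, and summing over j
-- yields the factor t^t.

open import Defs
open import Data.Nat using (ℕ; zero; suc; _+_; _!; _*_; _^_; _≤_; _<_; z≤n; s≤s; s≤s⁻¹; >-nonZero)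
open import Data.Nat.Properties
open import Data.Nat.Combinatorics using (_C_; nCk+nC[k+1]≡[n+1]C[k+1])
open import Data.Fin using (Fin; toℕ; inject≤)
import Data.Fin as F
open import Data.Fin.Properties using (toℕ<n)
open import Data.Product using (_,_)
open import Data.Sum using (inj₁; inj₂)
open import Relation.Binary.PropositionalEquality using (_≡_; refl; sym; cong; cong₂)
open import Data.Nat.Tactic.RingSolver using (solve-∀)

open ≤-Reasoning

sumFin-mono-≤ : ∀ n {f g : Fin n → ℕ} → (∀ i → f i ≤ g i) → sumFin n f ≤ sumFin n g
sumFin-mono-≤ zero    f≤g = z≤n
sumFin-mono-≤ (suc n) f≤g = +-mono-≤ (f≤g F.zero) (sumFin-mono-≤ n (λ i → f≤g (F.suc i)))

sumFin-distrib-+ : ∀ n (f g : Fin n → ℕ) → sumFin n (λ i → f i + g i) ≡ sumFin n f + sumFin n g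
sumFin-distrib-+ zero    f g = refl
sumFin-distrib-+ (suc n) f g = begin-equality
  f₀ + g₀ + sumFin n (λ i → f (F.suc i) + g (F.suc i))
    ≡⟨ cong (f₀ + g₀ +_) (sumFin-distrib-+ n _ _) ⟩
  f₀ + g₀ + (sumFin n (λ i → f (F.suc i)) + sumFin n (λ i → g (F.suc i)))
    ≡⟨ swap-middle f₀ g₀ _ _ ⟩
  f₀ + sumFin n (λ i → f (F.suc i)) + (g₀ + sumFin n (λ i → g (F.suc i))) ∎
  where
  f₀ = f F.zero
  g₀ = g F.zero
  swap-middle : ∀ a b c d → a + b + (c + d) ≡ a + c + (b + d)
  swap-middle = solve-∀

sumFin-*-distribˡ : ∀ n c (f : Fin n → ℕ) → sumFin n (λ i → c * f i) ≡ c * sumFin n f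
sumFin-*-distribˡ zero    c f = sym (*-zeroʳ c)
sumFin-*-distribˡ (suc n) c f = begin-equality
  c * f F.zero + sumFin n (λ i → c * f (F.suc i)) ≡⟨ cong (c * f F.zero +_) (sumFin-*-distribˡ n c _) ⟩
  c * f F.zero + c * sumFin n (λ i → f (F.suc i)) ≡⟨ *-distribˡ-+ c _ _ ⟨
  c * sumFin (suc n) f                             ∎

sumFin-const : ∀ n c → sumFin n (λ _ → c) ≡ n * c
sumFin-const zero    c = refl
sumFin-const (suc n) c = cong (c +_) (sumFin-const n c)

SimilarlyOrdered : ∀ {n} → (Fin n → ℕ) → (Fin n → ℕ) → Set
SimilarlyOrdered f g = ∀ i j → f i * g j + f j * g i ≤ f i * g i + f j * g j

rearrangement₂ : ∀ {x y X Y} → x ≤ y → X ≤ Y → y * X + x * Y ≤ x * X + y * Y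
rearrangement₂ {x} {_} {X} x≤y X≤Y with m≤n⇒∃[o]m+o≡n x≤y | m≤n⇒∃[o]m+o≡n X≤Y
... | d , refl | D , refl = begin
  (x + d) * X + x * (X + D)         ≤⟨ m≤m+n _ (d * D) ⟩
  (x + d) * X + x * (X + D) + d * D ≡⟨ expand x d X D ⟩
  x * X + (x + d) * (X + D)         ∎
  where
  expand : ∀ x d X D → (x + d) * X + x * (X + D) + d * D ≡ x * X + (x + d) * (X + D)
  expand = solve-∀

id-^-similarlyOrdered : ∀ {n} (f : Fin n → ℕ) e → SimilarlyOrdered f (λ i → f i ^ e)
id-^-similarlyOrdered f e i j with ≤-total (f i) (f j)
... | inj₁ fi≤fj = begin
  f i * f j ^ e + f j * f i ^ e ≡⟨ +-comm (f i * f j ^ e) _ ⟩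
  f j * f i ^ e + f i * f j ^ e ≤⟨ rearrangement₂ fi≤fj (^-monoˡ-≤ e fi≤fj) ⟩
  f i * f i ^ e + f j * f j ^ e ∎
... | inj₂ fj≤fi = begin
  f i * f j ^ e + f j * f i ^ e ≤⟨ rearrangement₂ fj≤fi (^-monoˡ-≤ e fj≤fi) ⟩
  f j * f j ^ e + f i * f i ^ e ≡⟨ +-comm (f j * f j ^ e) _ ⟩
  f i * f i ^ e + f j * f j ^ e ∎

chebyshev : ∀ n (f g : Fin n → ℕ) → SimilarlyOrdered f g →
            sumFin n f * sumFin n g ≤ n * sumFin n (λ i → f i * g i)
chebyshev zero    f g sim = z≤n
chebyshev (suc n) f g sim = begin
  (a + A) * (b + B)                   ≡⟨ expand a A b B ⟩
  a * b + (a * B + A * b) + A * B     ≤⟨ +-mono-≤ (+-monoʳ-≤ (a * b) cross) tail ⟩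
  a * b + (n * (a * b) + C) + n * C   ≡⟨ collect a b n C ⟩
  suc n * (a * b + C)                 ∎
  where
  a = f F.zero
  b = g F.zero
  A = sumFin n (λ i → f (F.suc i))
  B = sumFin n (λ i → g (F.suc i))
  C = sumFin n (λ i → f (F.suc i) * g (F.suc i))
  tail : A * B ≤ n * C
  tail = chebyshev n _ _ (λ i j → sim (F.suc i) (F.suc j))
  cross : a * B + A * b ≤ n * (a * b) + C
  cross = begin
    a * B + A * b
      ≡⟨ cong₂ _+_ (sumFin-*-distribˡ n a _) (*-comm b A) ⟨
    sumFin n (λ i → a * g (F.suc i)) + b * A
      ≡⟨ cong (sumFin n (λ i → a * g (F.suc i)) +_) (sumFin-*-distribˡ n b _) ⟨
    sumFin n (λ i → a * g (F.suc i)) + sumFin n (λ i → b * f (F.suc i))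
      ≡⟨ sumFin-distrib-+ n _ _ ⟨
    sumFin n (λ i → a * g (F.suc i) + b * f (F.suc i))
      ≤⟨ sumFin-mono-≤ n (λ i → ≤-trans (≤-reflexive (cong (a * g (F.suc i) +_) (*-comm b _)))
                                        (sim F.zero (F.suc i))) ⟩
    sumFin n (λ i → a * b + f (F.suc i) * g (F.suc i))
      ≡⟨ sumFin-distrib-+ n _ _ ⟩
    sumFin n (λ _ → a * b) + C
      ≡⟨ cong (_+ C) (sumFin-const n (a * b)) ⟩
    n * (a * b) + C ∎
  expand : ∀ a A b B → (a + A) * (b + B) ≡ a * b + (a * B + A * b) + A * B
  expand = solve-∀
  collect : ∀ a b n C → a * b + (n * (a * b) + C) + n * C ≡ suc n * (a * b + C)
  collect = solve-∀

power-mean : ∀ n (f : Fin n → ℕ) k → sumFin n f ^ suc k ≤ n ^ k * sumFin n (λ i → f i ^ suc k)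
power-mean n f zero = begin
  sumFin n f * 1                      ≡⟨ *-identityʳ _ ⟩
  sumFin n f                          ≤⟨ sumFin-mono-≤ n (λ i → ≤-reflexive (sym (*-identityʳ (f i)))) ⟩
  sumFin n (λ i → f i * 1)            ≡⟨ +-identityʳ _ ⟨
  1 * sumFin n (λ i → f i * 1)        ∎
power-mean n f (suc k) = begin
  Σf * Σf ^ suc k                     ≤⟨ *-monoʳ-≤ Σf (power-mean n f k) ⟩
  Σf * (n ^ k * Σfᵏ)                  ≡⟨ x*[y*z]≡y*[x*z] Σf (n ^ k) Σfᵏ ⟩
  n ^ k * (Σf * Σfᵏ)                  ≤⟨ *-monoʳ-≤ (n ^ k) (chebyshev n f _ (id-^-similarlyOrdered f (suc k))) ⟩
  n ^ k * (n * sumFin n (λ i → f i ^ suc (suc k))) ≡⟨ x*[y*z]≡y*[x*z] (n ^ k) n _ ⟩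
  n * (n ^ k * sumFin n (λ i → f i ^ suc (suc k))) ≡⟨ *-assoc n (n ^ k) _ ⟨
  n * n ^ k * sumFin n (λ i → f i ^ suc (suc k))   ∎
  where
  Σf = sumFin n f
  Σfᵏ = sumFin n (λ i → f i ^ suc k)
  x*[y*z]≡y*[x*z] : ∀ x y z → x * (y * z) ≡ y * (x * z)
  x*[y*z]≡y*[x*z] = solve-∀

[j+d]!≤j!*[j+d]^d : ∀ j d → (j + d) ! ≤ j ! * (j + d) ^ d
[j+d]!≤j!*[j+d]^d j zero rewrite +-identityʳ j = ≤-reflexive (sym (*-identityʳ (j !)))
[j+d]!≤j!*[j+d]^d j (suc d) rewrite +-suc j d = begin
  suc n * n !                         ≤⟨ *-monoʳ-≤ (suc n) ([j+d]!≤j!*[j+d]^d j d) ⟩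
  suc n * (j ! * n ^ d)               ≤⟨ *-monoʳ-≤ (suc n) (*-monoʳ-≤ (j !) (^-monoˡ-≤ d (n≤1+n n))) ⟩
  suc n * (j ! * suc n ^ d)           ≡⟨ x*[y*z]≡y*[x*z] (suc n) (j !) _ ⟩
  j ! * (suc n * suc n ^ d)           ∎
  where
  n = j + d
  x*[y*z]≡y*[x*z] : ∀ x y z → x * (y * z) ≡ y * (x * z)
  x*[y*z]≡y*[x*z] = solve-∀

bernoulli : ∀ n k → n ^ suc k + suc k * n ^ k ≤ suc n ^ suc k
bernoulli n zero = ≤-reflexive (expand n)
  where
  expand : ∀ n → n * 1 + 1 * 1 ≡ (1 + n) * 1
  expand = solve-∀
bernoulli n (suc k) = begin
  n * (n * P) + suc (suc k) * (n * P)               ≤⟨ m≤m+n _ (P + k * P) ⟩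
  n * (n * P) + suc (suc k) * (n * P) + (P + k * P) ≡⟨ factor n P k ⟩
  suc n * (n * P + suc k * P)                       ≤⟨ *-monoʳ-≤ (suc n) (bernoulli n k) ⟩
  suc n * suc n ^ suc k                             ∎
  where
  P = n ^ k
  factor : ∀ n P k → n * (n * P) + (2 + k) * (n * P) + (P + k * P) ≡ (1 + n) * (n * P + (1 + k) * P)
  factor = solve-∀

k!*nCk≤n^k : ∀ n k → k ! * (n C k) ≤ n ^ k
k!*nCk≤n^k zero    zero    = ≤-refl
k!*nCk≤n^k zero    (suc k) = ≤-reflexive (*-zeroʳ (suc k !))
k!*nCk≤n^k (suc n) zero    = ≤-refl
k!*nCk≤n^k (suc n) (suc k) = begin
  suc k * k ! * (suc n C suc k)                          ≡⟨ cong (suc k * k ! *_) (nCk+nC[k+1]≡[n+1]C[k+1] n k) ⟨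
  suc k * k ! * (n C k + n C suc k)                      ≡⟨ distribute (suc k) (k !) (n C k) (n C suc k) ⟩
  suc k * (k ! * (n C k)) + suc k * k ! * (n C suc k)    ≤⟨ +-mono-≤ (*-monoʳ-≤ (suc k) (k!*nCk≤n^k n k))
                                                                      (k!*nCk≤n^k n (suc k)) ⟩
  suc k * n ^ k + n ^ suc k                              ≡⟨ +-comm (suc k * n ^ k) _ ⟩
  n ^ suc k + suc k * n ^ k                              ≤⟨ bernoulli n k ⟩
  suc n ^ suc k                                          ∎
  where
  distribute : ∀ a b c d → a * b * (c + d) ≡ a * (b * c) + a * b * d
  distribute = solve-∀

prefixSum≡sumFin-inject≤ : ∀ {t} (m : Fin t → ℕ) j (j≤t : j ≤ t) →
                           prefixSum m j ≡ sumFin j (λ i → m (inject≤ i j≤t))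
prefixSum≡sumFin-inject≤ {zero}  m zero    z≤n       = refl
prefixSum≡sumFin-inject≤ {suc t} m zero    _         = refl
prefixSum≡sumFin-inject≤ {suc t} m (suc j) (s≤s j≤t) = cong (m F.zero +_) (prefixSum≡sumFin-inject≤ _ j j≤t)

sumFin-inject≤-≤ : ∀ {t} (f : Fin t → ℕ) j (j≤t : j ≤ t) → sumFin j (λ i → f (inject≤ i j≤t)) ≤ sumFin t f
sumFin-inject≤-≤ {zero}  f zero    z≤n       = ≤-refl
sumFin-inject≤-≤ {suc t} f zero    _         = z≤n
sumFin-inject≤-≤ {suc t} f (suc j) (s≤s j≤t) = +-monoʳ-≤ (f F.zero) (sumFin-inject≤-≤ _ j j≤t)

prefixSum^≤ : ∀ {t} (m : Fin t → ℕ) → (∀ i → 0 < m i) → ∀ k → suc k ≤ t →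
              prefixSum m (suc k) ^ suc k ≤ t ^ k * sumFin t (λ i → m i ^ t)
prefixSum^≤ {t} m pos k k<t = begin
  prefixSum m (suc k) ^ suc k            ≡⟨ cong (_^ suc k) (prefixSum≡sumFin-inject≤ m (suc k) k<t) ⟩
  sumFin (suc k) m′ ^ suc k              ≤⟨ power-mean (suc k) m′ k ⟩
  suc k ^ k * sumFin (suc k) (λ i → m′ i ^ suc k)
    ≤⟨ *-mono-≤ (^-monoˡ-≤ k k<t) (sumFin-mono-≤ (suc k) (λ i → ^-monoʳ-≤ (m′ i) {{>-nonZero (pos _)}} k<t)) ⟩
  t ^ k * sumFin (suc k) (λ i → m′ i ^ t) ≤⟨ *-monoʳ-≤ (t ^ k) (sumFin-inject≤-≤ (λ i → m i ^ t) (suc k) k<t) ⟩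
  t ^ k * sumFin t (λ i → m i ^ t)       ∎
  where
  m′ : Fin (suc k) → ℕ
  m′ i = m (inject≤ i k<t)

summand-bound : ∀ {t} (m : Fin (suc t) → ℕ) → (∀ i → 0 < m i) → ∀ k → k ≤ t →
                suc t ! * (prefixSum m (suc k) C suc k) ≤ suc t ^ t * sumFin (suc t) (λ i → m i ^ suc t)
summand-bound m pos k k≤t with m≤n⇒∃[o]m+o≡n k≤t
... | d , refl = begin
  T ! * (S C suc k)                      ≤⟨ *-monoˡ-≤ (S C suc k) ([j+d]!≤j!*[j+d]^d (suc k) d) ⟩
  suc k ! * T ^ d * (S C suc k)          ≡⟨ x*y*z≡y*[x*z] (suc k !) (T ^ d) (S C suc k) ⟩
  T ^ d * (suc k ! * (S C suc k))        ≤⟨ *-monoʳ-≤ (T ^ d) (k!*nCk≤n^k S (suc k)) ⟩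
  T ^ d * S ^ suc k                      ≤⟨ *-monoʳ-≤ (T ^ d) (prefixSum^≤ m pos k (s≤s k≤t)) ⟩
  T ^ d * (T ^ k * R)                    ≡⟨ x*[y*z]≡y*x*z (T ^ d) (T ^ k) R ⟩
  T ^ k * T ^ d * R                      ≡⟨ cong (_* R) (^-distribˡ-+-* T k d) ⟨
  T ^ (k + d) * R                        ∎
  where
  T = suc (k + d)
  S = prefixSum m (suc k)
  R = sumFin T (λ i → m i ^ T)
  x*y*z≡y*[x*z] : ∀ x y z → x * y * z ≡ y * (x * z)
  x*y*z≡y*[x*z] = solve-∀
  x*[y*z]≡y*x*z : ∀ x y z → x * (y * z) ≡ y * x * z
  x*[y*z]≡y*x*z = solve-∀

lemma5 : (t : ℕ) → 0 < t → (m : Fin t → ℕ) → (∀ i → 0 < m i) →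
           (t !) * sumFin t (λ j → prefixSum m (suc (toℕ j)) C suc (toℕ j))
             ≤ (t ^ t) * sumFin t (λ i → m i ^ t)
lemma5 (suc t) _ m pos = begin
  suc t ! * sumFin (suc t) binomial               ≡⟨ sumFin-*-distribˡ (suc t) (suc t !) binomial ⟨
  sumFin (suc t) (λ j → suc t ! * binomial j)    ≤⟨ sumFin-mono-≤ (suc t) (λ j → summand-bound m pos (toℕ j) (s≤s⁻¹ (toℕ<n j))) ⟩
  sumFin (suc t) (λ _ → suc t ^ t * R)           ≡⟨ sumFin-const (suc t) (suc t ^ t * R) ⟩
  suc t * (suc t ^ t * R)                        ≡⟨ *-assoc (suc t) (suc t ^ t) R ⟨
  suc t ^ suc t * R                              ∎
  where
  binomial : Fin (suc t) → ℕ
  binomial j = prefixSum m (suc (toℕ j)) C suc (toℕ j)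
  R = sumFin (suc t) (λ i → m i ^ suc t)
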